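{- Let $K=\mathbb Q(\zeta_5)\subseteq\mathbb C$ with $\zeta_5=\exp(2\pi i/5)$, let $\mathcal O_K$ be its ring of integers, and let $\sigma:K\hookrightarrow\mathbb C$ be the embedding with $\sigma(\zeta_5)=\zeta_5^2$; write $z^{\sigma}=\sigma(z)$. Let $\mathcal S=\{z\in\mathcal O_K : |z^{\sigma}|\leq 1\}$. If $z_1,z_2\in\mathcal S$ with $z_1\neq z_2$, then $|z_1-z_2|\geq\frac{\sqrt5-1}{2}$.
   Context: Elements of $K$ are regarded as complex numbers via the inclusion $K\subseteq\mathbb C$, and $|\cdot|$ is the complex absolute value. -}

module Defs where

open import Data.Integer using (ℤ; _+_; _-_; _*_; -_; _≤_; _<_; +_; 0ℤ)
open import Data.Product using (_×_)
open import Data.Sum using (_⊎_)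

record ℤ√5 : Set where
  constructor _+_√5
  field
    rat : ℤ
    irr : ℤ
open ℤ√5 public

_-√_ : ℤ√5 → ℤ√5 → ℤ√5
(a + b √5) -√ (c + d √5) = (a - c) + (b - d) √5

-- a + b√5 ≥ 0 as a real number (√5 the positive square root), decided
-- by sign cases and squaring.
NonNeg : ℤ√5 → Set
NonNeg (a + b √5) =
    (0ℤ ≤ a × 0ℤ ≤ b)
  ⊎ (0ℤ ≤ a × b < 0ℤ × (+ 5) * (b * b) ≤ a * a)
  ⊎ (a < 0ℤ × 0ℤ < b × a * a ≤ (+ 5) * (b * b))

_≤√_ : ℤ√5 → ℤ√5 → Set
x ≤√ y = NonNeg (y -√ x)

-- O_K = ℤ[ζ₅], ζ = ζ₅ = exp(2πi/5); every element is uniquely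
-- c0 + c1 ζ + c2 ζ² + c3 ζ³ with cᵢ ∈ ℤ (power basis, [K:ℚ] = 4).
record OK : Set where
  constructor ok
  field
    c0 c1 c2 c3 : ℤ
open OK public

_-K_ : OK → OK → OK
ok a0 a1 a2 a3 -K ok b0 b1 b2 b3 = ok (a0 - b0) (a1 - b1) (a2 - b2) (a3 - b3)

-- Auxiliary (non-unique) representation a0 + a1ζ + a2ζ² + a3ζ³ + a4ζ⁴.
record Cyc5 : Set where
  constructor cyc
  field
    a0 a1 a2 a3 a4 : ℤ

toCyc : OK → Cyc5
toCyc (ok x0 x1 x2 x3) = cyc x0 x1 x2 x3 0ℤ

-- σ : ζ ↦ ζ²  (ring automorphism of K; ζ^j ↦ ζ^{2j mod 5}):
-- a0 + a1ζ + a2ζ² + a3ζ³ + a4ζ⁴ ↦ a0 + a3ζ + a1ζ² + a4ζ³ + a2ζ⁴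
σ : Cyc5 → Cyc5
σ (cyc x0 x1 x2 x3 x4) = cyc x0 x3 x1 x4 x2

-- Twice the squared complex absolute value, as an element of ℤ[√5]:
-- z · conj z = c0 + c1 (ζ + ζ⁴) + c2 (ζ² + ζ³) with
-- ζ + ζ⁴ = (√5 - 1)/2, ζ² + ζ³ = (-√5 - 1)/2, and cₖ = Σ_j a_j a_{j+k mod 5}.
twiceAbsSq : Cyc5 → ℤ√5
twiceAbsSq (cyc x0 x1 x2 x3 x4) =
  ((+ 2) * k0 - k1 - k2) + (k1 - k2) √5
  where
  k0 = x0 * x0 + x1 * x1 + x2 * x2 + x3 * x3 + x4 * x4
  k1 = x0 * x1 + x1 * x2 + x2 * x3 + x3 * x4 + x4 * x0
  k2 = x0 * x2 + x1 * x3 + x2 * x4 + x3 * x0 + x4 * x1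

-- |z|² ≤ 1  ⇔  2|z|² ≤ 2 ;  S = { z ∈ O_K : |σ z| ≤ 1 }
InS : OK → Set
InS z = twiceAbsSq (σ (toCyc z)) ≤√ ((+ 2) + 0ℤ √5)

-- |z1 - z2| ≥ (√5-1)/2  ⇔  2|z1 - z2|² ≥ 2((√5-1)/2)² = 3 - √5

{-# OPTIONS --safe #-}
-- For z = z₁ - z₂ the number x = 2|z|² lies in ℤ[√5], and since σ restricts to
-- √5 ↦ -√5 on ℤ[√5], its conjugate is x̄ = 2|σz|². Both are ≥ 0, x ≠ 0 because
-- z ≠ 0, and x̄ ≤ 8 by the parallelogram law since |σz₁|, |σz₂| ≤ 1. Writing
-- x = P + Q√5: if Q ≥ 0 then P ≥ 1; if Q = -1 then P ≥ √5, so P ≥ 3; and Q ≤ -2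
-- is impossible, as x̄ = P - Q√5 ≥ 2|Q|√5 > 8. In each case x ≥ 3 - √5, which
-- is 2((√5 - 1)/2)².
module Submission where

open import Defs
open import Data.Empty using (⊥-elim)
open import Data.Integer
  using (ℤ; +_; -[1+_]; 0ℤ; 1ℤ; -1ℤ; _+_; _-_; _*_; -_; _≤_; _<_; +≤+; +<+)
open import Data.Integer.Properties
  using ( +-comm; +-mono-≤; ≤-antisym; <⇒≤; <-≤-trans; neg-mono-≤; neg-mono-<; neg-involutive
        ; neg-distrib-+; +-identityˡ; +◃n≡+n; i≤j⇒0≤j-i; 0≤i-j⇒j≤i; i-j≡0⇒i≡j
        ; i*j≡0⇒i≡0∨j≡0)
open import Data.Integer.Tactic.RingSolver using (solve; solve-∀)
open import Data.List using (List; []; _∷_)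
open import Data.List.Relation.Unary.All as All using (All)
open import Data.Nat as ℕ using (z≤n)
open import Data.Product using (_×_; _,_; proj₁; proj₂)
open import Data.Sum using (_⊎_; inj₁; inj₂; [_,_]′)
open import Function using (id; _∘_)
open import Relation.Binary.PropositionalEquality
  using (_≡_; _≢_; refl; sym; trans; cong; cong₂; subst; subst₂; module ≡-Reasoning)
open import Relation.Nullary using (¬_)
open ≡-Reasoning

nonneg-by : ∀ {b} a → 0ℤ ≤ a → a ≡ b → 0ℤ ≤ b
nonneg-by _ p refl = p

+-nonneg : ∀ {a b} → 0ℤ ≤ a → 0ℤ ≤ b → 0ℤ ≤ a + b
+-nonneg = +-mono-≤

*-nonneg : ∀ {a b} → 0ℤ ≤ a → 0ℤ ≤ b → 0ℤ ≤ a * b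
*-nonneg {+ m} {+ n} _ _ rewrite +◃n≡+n (m ℕ.* n) = +≤+ z≤n

scale-nonneg : ∀ k {a} → 0ℤ ≤ a → 0ℤ ≤ + k * a
scale-nonneg k = *-nonneg {+ k} (+≤+ z≤n)

square-nonneg : ∀ a → 0ℤ ≤ a * a
square-nonneg (+ n)    = *-nonneg {+ n} {+ n} (+≤+ z≤n) (+≤+ z≤n)
square-nonneg -[1+ n ] = square-nonneg (+ ℕ.suc n)

nonpos⊎pos : ∀ x → 0ℤ ≤ - x ⊎ 0ℤ ≤ x - 1ℤ
nonpos⊎pos (+ ℕ.zero)  = inj₁ (+≤+ z≤n)
nonpos⊎pos (+ ℕ.suc n) = inj₂ (+≤+ z≤n)
nonpos⊎pos -[1+ n ]    = inj₁ (+≤+ z≤n)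

pos⇒nonneg : ∀ x → 0ℤ ≤ x - 1ℤ → 0ℤ ≤ x
pos⇒nonneg x p = nonneg-by ((x - 1ℤ) + 1ℤ) (+-nonneg p (+≤+ z≤n)) (solve (x ∷ []))

pos⇒¬nonpos : ∀ x → 0ℤ ≤ x - 1ℤ → ¬ (0ℤ ≤ - x)
pos⇒¬nonpos x p q = 0≰-1 (nonneg-by ((x - 1ℤ) + - x) (+-nonneg p q) (solve (x ∷ [])))
  where
  0≰-1 : ¬ (0ℤ ≤ -1ℤ)
  0≰-1 ()

pos⇒0< : ∀ x → 0ℤ ≤ x - 1ℤ → 0ℤ < x
pos⇒0< x p = <-≤-trans (+<+ (ℕ.s≤s z≤n)) (0≤i-j⇒j≤i p)

neg⇒<0 : ∀ x → 0ℤ ≤ - x - 1ℤ → x < 0ℤ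
neg⇒<0 x p = subst (_< 0ℤ) (neg-involutive x) (neg-mono-< (pos⇒0< (- x) p))

nonneg∧nonpos⇒0 : ∀ x → 0ℤ ≤ x → 0ℤ ≤ - x → x ≡ 0ℤ
nonneg∧nonpos⇒0 x p q = ≤-antisym (subst (_≤ 0ℤ) (neg-involutive x) (neg-mono-≤ q)) p

square-mono : ∀ x y → 0ℤ ≤ x → 0ℤ ≤ y - x → 0ℤ ≤ y * y - x * x
square-mono x y p q =
  nonneg-by ((y - x) * ((y - x) + (x + x))) (*-nonneg q (+-nonneg q (+-nonneg p p))) (solve (x ∷ y ∷ []))

square-pos : ∀ x → 0ℤ ≤ x - 1ℤ → 0ℤ ≤ x * x - 1ℤ
square-pos x p =
  nonneg-by ((x - 1ℤ) * (x - 1ℤ) + ((x - 1ℤ) + (x - 1ℤ))) (+-nonneg (*-nonneg p p) (+-nonneg p p)) (solve (x ∷ []))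

≤-from-squares : ∀ x y → 0ℤ ≤ x → 0ℤ ≤ y → 0ℤ ≤ y * y - x * x → 0ℤ ≤ y - x
≤-from-squares x y p q h with nonpos⊎pos (x - y)
... | inj₁ r = nonneg-by (- (x - y)) r (solve (x ∷ y ∷ []))
... | inj₂ r = ⊥-elim (pos⇒¬nonpos (x * x - y * y)
      (nonneg-by ((x - y - 1ℤ) * (x + y) + (x - y - 1ℤ) + (y + y))
                 (+-nonneg (+-nonneg (*-nonneg r (+-nonneg p q)) r) (+-nonneg q q)) (solve (x ∷ y ∷ [])))
      (nonneg-by (y * y - x * x) h (solve (x ∷ y ∷ []))))

*-mono-nonneg : ∀ a b c d → 0ℤ ≤ a → 0ℤ ≤ b - a → 0ℤ ≤ c → 0ℤ ≤ d - c → 0ℤ ≤ b * d - a * c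
*-mono-nonneg a b c d pa pab pc pcd = nonneg-by ((b - a) * ((d - c) + c) + a * (d - c))
  (+-nonneg (*-nonneg pab (+-nonneg pcd pc)) (*-nonneg pa pcd)) (solve (a ∷ b ∷ c ∷ d ∷ []))

*-cancelʳ-nonneg : ∀ k x → 0ℤ ≤ k - 1ℤ → 0ℤ ≤ x * k → 0ℤ ≤ x
*-cancelʳ-nonneg k x hk h with nonpos⊎pos (- x)
... | inj₁ r = nonneg-by (- - x) r (neg-involutive x)
... | inj₂ r = ⊥-elim (pos⇒¬nonpos (- (x * k))
      (nonneg-by ((k - 1ℤ) * (- x - 1ℤ) + (k - 1ℤ) + (- x - 1ℤ))
                 (+-nonneg (+-nonneg (*-nonneg hk r) hk) r) (solve (k ∷ x ∷ [])))
      (nonneg-by (x * k) h (solve (k ∷ x ∷ []))))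

sumOfSquares : List ℤ → ℤ
sumOfSquares []                = 0ℤ
sumOfSquares (x ∷ [])          = x * x
sumOfSquares (x ∷ xs@(_ ∷ _)) = x * x + sumOfSquares xs

sumOfSquares-nonneg : ∀ xs → 0ℤ ≤ sumOfSquares xs
sumOfSquares-nonneg []                = +≤+ z≤n
sumOfSquares-nonneg (x ∷ [])          = square-nonneg x
sumOfSquares-nonneg (x ∷ xs@(_ ∷ _)) = +-nonneg (square-nonneg x) (sumOfSquares-nonneg xs)

+-nonneg-≡0 : ∀ {a b} → 0ℤ ≤ a → 0ℤ ≤ b → a + b ≡ 0ℤ → a ≡ 0ℤ × b ≡ 0ℤ
+-nonneg-≡0 {a} {b} a≥0 b≥0 a+b≡0 = a≡0 , trans b≡-a (cong -_ a≡0)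
  where
  b≡-a : b ≡ - a
  b≡-a = begin
    b            ≡⟨ solve (a ∷ b ∷ []) ⟩
    (a + b) - a  ≡⟨ cong (_- a) a+b≡0 ⟩
    0ℤ - a       ≡⟨ +-identityˡ (- a) ⟩
    - a          ∎
  a≡0 : a ≡ 0ℤ
  a≡0 = nonneg∧nonpos⇒0 a a≥0 (subst (0ℤ ≤_) b≡-a b≥0)

square≡0 : ∀ x → x * x ≡ 0ℤ → x ≡ 0ℤ
square≡0 x e = [ id , id ]′ (i*j≡0⇒i≡0∨j≡0 x e)

sumOfSquares≡0 : ∀ xs → sumOfSquares xs ≡ 0ℤ → All (_≡ 0ℤ) xs
sumOfSquares≡0 []                e = All.[]
sumOfSquares≡0 (x ∷ [])          e = square≡0 x e All.∷ All.[]
sumOfSquares≡0 (x ∷ xs@(_ ∷ _)) e = square≡0 x (proj₁ split) All.∷ sumOfSquares≡0 xs (proj₂ split)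
  where
  split : x * x ≡ 0ℤ × sumOfSquares xs ≡ 0ℤ
  split = +-nonneg-≡0 (square-nonneg x) (sumOfSquares-nonneg xs) e

-- Comparing integers with integer multiples of √5

-- n ≤√5· β means n ≤ √5 β in ℝ. Unlike the cases of NonNeg, the three
-- certificates use weak inequalities and may overlap.
infix 4 _≤√5·_

data _≤√5·_ (n β : ℤ) : Set where
  by-sign    : 0ℤ ≤ - n → 0ℤ ≤ β → n ≤√5· β
  by-square⁺ : 0ℤ ≤ n → 0ℤ ≤ β → 0ℤ ≤ (+ 5) * (β * β) - n * n → n ≤√5· β
  by-square⁻ : 0ℤ ≤ - n → 0ℤ ≤ - β → 0ℤ ≤ n * n - (+ 5) * (β * β) → n ≤√5· β

≤√5·-monoˡ : ∀ {n n′ β} → 0ℤ ≤ n - n′ → n ≤√5· β → n′ ≤√5· β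
≤√5·-monoˡ {n} {n′} d (by-sign p q) =
  by-sign (nonneg-by (- n + (n - n′)) (+-nonneg p d) (solve (n ∷ n′ ∷ []))) q
≤√5·-monoˡ {n} {n′} {β} d (by-square⁺ p q h) with nonpos⊎pos n′
... | inj₁ r = by-sign r q
... | inj₂ r = by-square⁺ n′≥0 q
  (nonneg-by (((+ 5) * (β * β) - n * n) + (n * n - n′ * n′)) (+-nonneg h (square-mono n′ n n′≥0 d))
             (solve (n ∷ n′ ∷ β ∷ [])))
  where
  n′≥0 : 0ℤ ≤ n′
  n′≥0 = pos⇒nonneg n′ r
≤√5·-monoˡ {n} {n′} {β} d (by-square⁻ p q h) = by-square⁻ -n′≥0 q
  (nonneg-by ((- n′ * - n′ - - n * - n) + (n * n - (+ 5) * (β * β)))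
             (+-nonneg (square-mono (- n) (- n′) p (nonneg-by (n - n′) d (solve (n ∷ n′ ∷ [])))) h)
             (solve (n ∷ n′ ∷ β ∷ [])))
  where
  -n′≥0 : 0ℤ ≤ - n′
  -n′≥0 = nonneg-by (- n + (n - n′)) (+-nonneg p d) (solve (n ∷ n′ ∷ []))

≤√5·-monoʳ : ∀ {n β β′} → 0ℤ ≤ β′ - β → n ≤√5· β → n ≤√5· β′
≤√5·-monoʳ {n} {β} {β′} d (by-sign p q) =
  by-sign p (nonneg-by (β + (β′ - β)) (+-nonneg q d) (solve (β ∷ β′ ∷ [])))
≤√5·-monoʳ {n} {β} {β′} d (by-square⁺ p q h) = by-square⁺ p β′≥0
  (nonneg-by ((+ 5) * (β′ * β′ - β * β) + ((+ 5) * (β * β) - n * n))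
             (+-nonneg (scale-nonneg 5 (square-mono β β′ q d)) h) (solve (n ∷ β ∷ β′ ∷ [])))
  where
  β′≥0 : 0ℤ ≤ β′
  β′≥0 = nonneg-by (β + (β′ - β)) (+-nonneg q d) (solve (β ∷ β′ ∷ []))
≤√5·-monoʳ {n} {β} {β′} d (by-square⁻ p q h) with nonpos⊎pos β′
... | inj₂ r = by-sign p (pos⇒nonneg β′ r)
... | inj₁ r = by-square⁻ p r
  (nonneg-by ((n * n - (+ 5) * (β * β)) + (+ 5) * (- β * - β - - β′ * - β′))
             (+-nonneg h (scale-nonneg 5
               (square-mono (- β′) (- β) r (nonneg-by (β′ - β) d (solve (β ∷ β′ ∷ []))))))
             (solve (n ∷ β ∷ β′ ∷ [])))

≤√5·-nonpos : ∀ {n β} → 0ℤ ≤ - β → n ≤√5· β → 0ℤ ≤ - n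
≤√5·-nonpos _ (by-sign p _) = p
≤√5·-nonpos _ (by-square⁻ p _ _) = p
≤√5·-nonpos {n} {β} β≤0 (by-square⁺ p q h) with nonneg∧nonpos⇒0 β q β≤0
... | refl = nonneg-by (0ℤ - n)
  (≤-from-squares n 0ℤ p (+≤+ z≤n) (nonneg-by ((+ 5) * (0ℤ * 0ℤ) - n * n) h (solve (n ∷ []))))
  (solve (n ∷ []))

≤√5·-nonneg : ∀ {n β} → 0ℤ ≤ n → n ≤√5· β → 0ℤ ≤ β
≤√5·-nonneg _ (by-sign _ q) = q
≤√5·-nonneg _ (by-square⁺ _ q _) = q
≤√5·-nonneg {n} {β} n≥0 (by-square⁻ p q h) with nonneg∧nonpos⇒0 n n≥0 p
... | refl = nonneg-by (0ℤ - - β)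
  (≤-from-squares (- β) 0ℤ q (+≤+ z≤n)
    (nonneg-by ((0ℤ * 0ℤ - (+ 5) * (β * β)) + (+ 4) * (β * β))
               (+-nonneg h (scale-nonneg 4 (square-nonneg β))) (solve (β ∷ []))))
  (solve (β ∷ []))

≤√5·-square⁻ : ∀ {n β} → 0ℤ ≤ - β - 1ℤ → n ≤√5· β → 0ℤ ≤ n * n - (+ 5) * (β * β)
≤√5·-square⁻ {β = β} β≤-1 (by-sign _ β≥0) =
  ⊥-elim (pos⇒¬nonpos (- β) β≤-1 (nonneg-by β β≥0 (sym (neg-involutive β))))
≤√5·-square⁻ {β = β} β≤-1 (by-square⁺ _ β≥0 _) =
  ⊥-elim (pos⇒¬nonpos (- β) β≤-1 (nonneg-by β β≥0 (sym (neg-involutive β))))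
≤√5·-square⁻ _ (by-square⁻ _ _ h) = h

≤√5·-subst : ∀ {n n′ β β′} → n ≤√5· β → n ≡ n′ → β ≡ β′ → n′ ≤√5· β′
≤√5·-subst h refl refl = h

≤√5·-+-sign : ∀ {n β m δ} → 0ℤ ≤ - n → 0ℤ ≤ β → m ≤√5· δ → n + m ≤√5· β + δ
≤√5·-+-sign {n} {β} {m} {δ} n≤0 β≥0 h =
  ≤√5·-monoʳ {β = δ} (nonneg-by β β≥0 (solve (β ∷ δ ∷ [])))
             (≤√5·-monoˡ {n = m} (nonneg-by (- n) n≤0 (solve (n ∷ m ∷ []))) h)

≤√5·-+-pos : ∀ {n β m δ} →
  0ℤ ≤ n → 0ℤ ≤ β → 0ℤ ≤ (+ 5) * (β * β) - n * n →
  0ℤ ≤ m → 0ℤ ≤ δ → 0ℤ ≤ (+ 5) * (δ * δ) - m * m → n + m ≤√5· β + δ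
≤√5·-+-pos {n} {β} {m} {δ} n≥0 β≥0 n²≤5β² m≥0 δ≥0 m²≤5δ² =
  by-square⁺ (+-nonneg n≥0 m≥0) (+-nonneg β≥0 δ≥0)
  (nonneg-by (((+ 5) * (β * β) - n * n) + ((+ 5) * (δ * δ) - m * m) + (+ 2) * ((+ 5) * (β * δ) - n * m))
             (+-nonneg (+-nonneg n²≤5β² m²≤5δ²) (scale-nonneg 2 nm≤5βδ)) (solve (n ∷ m ∷ β ∷ δ ∷ [])))
  where
  nm≤5βδ : 0ℤ ≤ (+ 5) * (β * δ) - n * m
  nm≤5βδ = ≤-from-squares (n * m) ((+ 5) * (β * δ)) (*-nonneg n≥0 m≥0) (scale-nonneg 5 (*-nonneg β≥0 δ≥0))
    (nonneg-by (((+ 5) * (β * β)) * ((+ 5) * (δ * δ)) - (n * n) * (m * m))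
               (*-mono-nonneg (n * n) ((+ 5) * (β * β)) (m * m) ((+ 5) * (δ * δ))
                              (square-nonneg n) n²≤5β² (square-nonneg m) m²≤5δ²)
               (solve (n ∷ m ∷ β ∷ δ ∷ [])))

≤√5·-+-neg : ∀ {n β m δ} →
  0ℤ ≤ - n → 0ℤ ≤ - β → 0ℤ ≤ n * n - (+ 5) * (β * β) →
  0ℤ ≤ - m → 0ℤ ≤ - δ → 0ℤ ≤ m * m - (+ 5) * (δ * δ) → n + m ≤√5· β + δ
≤√5·-+-neg {n} {β} {m} {δ} n≤0 β≤0 5β²≤n² m≤0 δ≤0 5δ²≤m² =
  by-square⁻ (nonneg-by (- n + - m) (+-nonneg n≤0 m≤0) (solve (n ∷ m ∷ [])))
             (nonneg-by (- β + - δ) (+-nonneg β≤0 δ≤0) (solve (β ∷ δ ∷ [])))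
  (nonneg-by ((n * n - (+ 5) * (β * β)) + (m * m - (+ 5) * (δ * δ)) + (+ 2) * (n * m - (+ 5) * (β * δ)))
             (+-nonneg (+-nonneg 5β²≤n² 5δ²≤m²) (scale-nonneg 2 5βδ≤nm)) (solve (n ∷ m ∷ β ∷ δ ∷ [])))
  where
  5βδ≤nm : 0ℤ ≤ n * m - (+ 5) * (β * δ)
  5βδ≤nm = ≤-from-squares ((+ 5) * (β * δ)) (n * m)
    (nonneg-by ((+ 5) * (- β * - δ)) (scale-nonneg 5 (*-nonneg β≤0 δ≤0)) (solve (β ∷ δ ∷ [])))
    (nonneg-by (- n * - m) (*-nonneg n≤0 m≤0) (solve (n ∷ m ∷ [])))
    (nonneg-by ((n * n) * (m * m) - ((+ 5) * (β * β)) * ((+ 5) * (δ * δ)))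
               (*-mono-nonneg ((+ 5) * (β * β)) (n * n) ((+ 5) * (δ * δ)) (m * m)
                              (scale-nonneg 5 (square-nonneg β)) 5β²≤n²
                              (scale-nonneg 5 (square-nonneg δ)) 5δ²≤m²)
               (solve (n ∷ m ∷ β ∷ δ ∷ [])))

module _ {n β m δ : ℤ}
         (n≥0 : 0ℤ ≤ n) (β≥0 : 0ℤ ≤ β) (n²≤5β² : 0ℤ ≤ (+ 5) * (β * β) - n * n)
         (m≤0 : 0ℤ ≤ - m) (δ≤0 : 0ℤ ≤ - δ) (5δ²≤m² : 0ℤ ≤ m * m - (+ 5) * (δ * δ)) where

  private
    -- n / β ≤ √5 ≤ m / δ, cross-multiplied
    cross : 0ℤ ≤ - m * β - n * - δ
    cross = ≤-from-squares (n * - δ) (- m * β) (*-nonneg n≥0 δ≤0) (*-nonneg m≤0 β≥0)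
      (nonneg-by (((+ 5) * (β * β) - n * n) * (δ * δ) + (β * β) * (m * m - (+ 5) * (δ * δ)))
                 (+-nonneg (*-nonneg n²≤5β² (square-nonneg δ)) (*-nonneg (square-nonneg β) 5δ²≤m²))
                 (solve (n ∷ m ∷ β ∷ δ ∷ [])))

    sum-pos : 0ℤ ≤ β - 1ℤ → 0ℤ ≤ n + m → 0ℤ ≤ β + δ →
              0ℤ ≤ (+ 5) * ((β + δ) * (β + δ)) - (n + m) * (n + m)
    sum-pos β≥1 s≥0 t≥0 = *-cancelʳ-nonneg (β * β) _ (square-pos β β≥1)
      (nonneg-by ((n * (β + δ)) * (n * (β + δ)) - ((n + m) * β) * ((n + m) * β)
                  + ((+ 5) * (β * β) - n * n) * ((β + δ) * (β + δ)))
        (+-nonneg (square-mono ((n + m) * β) (n * (β + δ)) (*-nonneg s≥0 β≥0)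
                               (nonneg-by (- m * β - n * - δ) cross (solve (n ∷ m ∷ β ∷ δ ∷ []))))
                  (*-nonneg n²≤5β² (square-nonneg (β + δ))))
        (solve (n ∷ m ∷ β ∷ δ ∷ [])))

    sum-neg : 0ℤ ≤ - m - 1ℤ → 0ℤ ≤ - (n + m) → 0ℤ ≤ - (β + δ) →
              0ℤ ≤ (n + m) * (n + m) - (+ 5) * ((β + δ) * (β + δ))
    sum-neg -m≥1 s≤0 t≤0 = *-cancelʳ-nonneg (m * m) _
      (nonneg-by (- m * - m - 1ℤ) (square-pos (- m) -m≥1) (solve (m ∷ [])))
      (nonneg-by ((m * m - (+ 5) * (δ * δ)) * ((n + m) * (n + m))
                  + (+ 5) * ((- δ * - (n + m)) * (- δ * - (n + m)) - (- (β + δ) * - m) * (- (β + δ) * - m)))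
        (+-nonneg (*-nonneg 5δ²≤m² (square-nonneg (n + m)))
                  (scale-nonneg 5
                    (square-mono (- (β + δ) * - m) (- δ * - (n + m)) (*-nonneg t≤0 m≤0)
                                 (nonneg-by (- m * β - n * - δ) cross (solve (n ∷ m ∷ β ∷ δ ∷ []))))))
        (solve (n ∷ m ∷ β ∷ δ ∷ [])))

    sum-opposite : 0ℤ ≤ (n + m) - 1ℤ → ¬ (0ℤ ≤ - (β + δ) - 1ℤ)
    sum-opposite s≥1 t≤-1 = pos⇒¬nonpos ((n + m) * - δ + - m * - (β + δ))
      (nonneg-by (((n + m) - 1ℤ) * (- δ - 1ℤ) + ((n + m) - 1ℤ) + (- δ - 1ℤ) + - m * - (β + δ))
                 (+-nonneg (+-nonneg (+-nonneg (*-nonneg s≥1 -δ≥1) s≥1) -δ≥1)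
                           (*-nonneg m≤0 (pos⇒nonneg (- (β + δ)) t≤-1)))
                 (solve (n ∷ m ∷ β ∷ δ ∷ [])))
      (nonneg-by (- m * β - n * - δ) cross (solve (n ∷ m ∷ β ∷ δ ∷ [])))
      where
      -δ≥1 : 0ℤ ≤ - δ - 1ℤ
      -δ≥1 = nonneg-by ((- (β + δ) - 1ℤ) + β) (+-nonneg t≤-1 β≥0) (solve (β ∷ δ ∷ []))

  ≤√5·-+-mixed : n + m ≤√5· β + δ
  ≤√5·-+-mixed with nonpos⊎pos β | nonpos⊎pos (- m)
  ... | inj₁ β≤0 | _ =
    ≤√5·-+-sign (≤√5·-nonpos β≤0 (by-square⁺ n≥0 β≥0 n²≤5β²)) β≥0 (by-square⁻ m≤0 δ≤0 5δ²≤m²)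
  ... | inj₂ _ | inj₁ m≥0 = subst₂ _≤√5·_ (+-comm m n) (+-comm δ β)
    (≤√5·-+-sign m≤0 (≤√5·-nonneg (nonneg-by (- - m) m≥0 (neg-involutive m)) (by-square⁻ m≤0 δ≤0 5δ²≤m²))
                 (by-square⁺ n≥0 β≥0 n²≤5β²))
  ... | inj₂ β≥1 | inj₂ -m≥1 with nonpos⊎pos (n + m) | nonpos⊎pos (- (β + δ))
  ...   | inj₁ s≤0 | inj₁ t≤0 = by-sign s≤0 (nonneg-by (- - (β + δ)) t≤0 (neg-involutive (β + δ)))
  ...   | inj₁ s≤0 | inj₂ t≤-1 = by-square⁻ s≤0 t≤0 (sum-neg -m≥1 s≤0 t≤0)
    where
    t≤0 : 0ℤ ≤ - (β + δ)
    t≤0 = pos⇒nonneg (- (β + δ)) t≤-1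
  ...   | inj₂ s≥1 | inj₁ -t≤0 = by-square⁺ s≥0 t≥0 (sum-pos β≥1 s≥0 t≥0)
    where
    s≥0 : 0ℤ ≤ n + m
    s≥0 = pos⇒nonneg (n + m) s≥1
    t≥0 : 0ℤ ≤ β + δ
    t≥0 = nonneg-by (- - (β + δ)) -t≤0 (neg-involutive (β + δ))
  ...   | inj₂ s≥1 | inj₂ t≤-1 = ⊥-elim (sum-opposite s≥1 t≤-1)

≤√5·-+ : ∀ {n β m δ} → n ≤√5· β → m ≤√5· δ → n + m ≤√5· β + δ
≤√5·-+ (by-sign p q) h = ≤√5·-+-sign p q h
≤√5·-+ {n} {β} {m} {δ} h (by-sign p q) = subst₂ _≤√5·_ (+-comm m n) (+-comm δ β) (≤√5·-+-sign p q h)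
≤√5·-+ (by-square⁺ p q h) (by-square⁺ p′ q′ h′) = ≤√5·-+-pos p q h p′ q′ h′
≤√5·-+ (by-square⁻ p q h) (by-square⁻ p′ q′ h′) = ≤√5·-+-neg p q h p′ q′ h′
≤√5·-+ (by-square⁺ p q h) (by-square⁻ p′ q′ h′) = ≤√5·-+-mixed p q h p′ q′ h′
≤√5·-+ {n} {β} {m} {δ} (by-square⁻ p q h) (by-square⁺ p′ q′ h′) =
  subst₂ _≤√5·_ (+-comm m n) (+-comm δ β) (≤√5·-+-mixed p′ q′ h′ p q h)

≤√5·-*-cancelʳ : ∀ k {n β} → 0ℤ ≤ k - 1ℤ → n * k ≤√5· β * k → n ≤√5· β
≤√5·-*-cancelʳ k {n} {β} k≥1 (by-sign p q) =
  by-sign (*-cancelʳ-nonneg k (- n) k≥1 (nonneg-by (- (n * k)) p (solve (k ∷ n ∷ []))))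
          (*-cancelʳ-nonneg k β k≥1 q)
≤√5·-*-cancelʳ k {n} {β} k≥1 (by-square⁺ p q h) =
  by-square⁺ (*-cancelʳ-nonneg k n k≥1 p) (*-cancelʳ-nonneg k β k≥1 q)
    (*-cancelʳ-nonneg (k * k) _ (square-pos k k≥1)
      (nonneg-by ((+ 5) * ((β * k) * (β * k)) - (n * k) * (n * k)) h (solve (k ∷ n ∷ β ∷ []))))
≤√5·-*-cancelʳ k {n} {β} k≥1 (by-square⁻ p q h) =
  by-square⁻ (*-cancelʳ-nonneg k (- n) k≥1 (nonneg-by (- (n * k)) p (solve (k ∷ n ∷ []))))
             (*-cancelʳ-nonneg k (- β) k≥1 (nonneg-by (- (β * k)) q (solve (k ∷ β ∷ []))))
    (*-cancelʳ-nonneg (k * k) _ (square-pos k k≥1)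
      (nonneg-by ((n * k) * (n * k) - (+ 5) * ((β * k) * (β * k))) h (solve (k ∷ n ∷ β ∷ []))))

square-≤√5· : ∀ p q → - (p * p + (+ 5) * (q * q)) ≤√5· p * q + q * p
square-≤√5· p q = [ pq≤0⇒ , pq≥1⇒ ]′ (nonpos⊎pos (p * q))
  where
  norm≥0 : 0ℤ ≤ - - (p * p + (+ 5) * (q * q))
  norm≥0 = nonneg-by (p * p + (+ 5) * (q * q))
    (+-nonneg (square-nonneg p) (scale-nonneg 5 (square-nonneg q))) (solve (p ∷ q ∷ []))
  pq≥1⇒ : 0ℤ ≤ p * q - 1ℤ → - (p * p + (+ 5) * (q * q)) ≤√5· p * q + q * p
  pq≥1⇒ pq≥1 = by-sign norm≥0
    (nonneg-by ((+ 2) * (p * q)) (scale-nonneg 2 (pos⇒nonneg (p * q) pq≥1)) (solve (p ∷ q ∷ [])))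
  pq≤0⇒ : 0ℤ ≤ - (p * q) → - (p * p + (+ 5) * (q * q)) ≤√5· p * q + q * p
  pq≤0⇒ pq≤0 = by-square⁻ norm≥0
    (nonneg-by ((+ 2) * - (p * q)) (scale-nonneg 2 pq≤0) (solve (p ∷ q ∷ [])))
    (nonneg-by ((p * p - (+ 5) * (q * q)) * (p * p - (+ 5) * (q * q))) (square-nonneg (p * p - (+ 5) * (q * q)))
               (solve (p ∷ q ∷ [])))

-- ℤ[√5] as a subring of ℝ

infixl 6 _+√_
infixl 7 _·√_
infix 4 _≥0

_+√_ : ℤ√5 → ℤ√5 → ℤ√5
(a + b √5) +√ (c + d √5) = (a + c) + (b + d) √5

_·√_ : ℤ → ℤ√5 → ℤ√5
k ·√ (a + b √5) = (k * a) + (k * b) √5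

conj : ℤ√5 → ℤ√5
conj (a + b √5) = a + (- b) √5

fromℤ : ℤ → ℤ√5
fromℤ n = n + 0ℤ √5

_≥0 : ℤ√5 → Set
(a + b √5) ≥0 = - a ≤√5· b

NonNeg⇒≥0 : ∀ x → NonNeg x → x ≥0
NonNeg⇒≥0 (a + b √5) (inj₁ (a≥0 , b≥0)) = by-sign (nonneg-by a a≥0 (sym (neg-involutive a))) b≥0
NonNeg⇒≥0 (a + b √5) (inj₂ (inj₁ (a≥0 , b<0 , 5b²≤a²))) =
  by-square⁻ (nonneg-by a a≥0 (sym (neg-involutive a)))
             (nonneg-by (0ℤ - b) (i≤j⇒0≤j-i (<⇒≤ b<0)) (solve (b ∷ [])))
             (nonneg-by (a * a - (+ 5) * (b * b)) (i≤j⇒0≤j-i 5b²≤a²) (solve (a ∷ b ∷ [])))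
NonNeg⇒≥0 (a + b √5) (inj₂ (inj₂ (a<0 , 0<b , a²≤5b²))) =
  by-square⁺ (nonneg-by (0ℤ - a) (i≤j⇒0≤j-i (<⇒≤ a<0)) (solve (a ∷ [])) ) (<⇒≤ 0<b)
             (nonneg-by ((+ 5) * (b * b) - a * a) (i≤j⇒0≤j-i a²≤5b²) (solve (a ∷ b ∷ [])))

≥0⇒NonNeg : ∀ x → x ≥0 → NonNeg x
≥0⇒NonNeg (a + b √5) (by-sign -a≤0 b≥0) = inj₁ (nonneg-by (- - a) -a≤0 (neg-involutive a) , b≥0)
≥0⇒NonNeg (a + b √5) x≥0@(by-square⁺ -a≥0 b≥0 a²≤5b²) with nonpos⊎pos (- a) | nonpos⊎pos b
... | inj₁ a≥0 | _ = inj₁ (nonneg-by (- - a) a≥0 (neg-involutive a) , b≥0)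
... | inj₂ -a≥1 | inj₁ b≤0 = ⊥-elim (pos⇒¬nonpos (- a) -a≥1 (≤√5·-nonpos b≤0 x≥0))
... | inj₂ -a≥1 | inj₂ b≥1 = inj₂ (inj₂ (neg⇒<0 a -a≥1 , pos⇒0< b b≥1 ,
      0≤i-j⇒j≤i (nonneg-by {(+ 5) * (b * b) - a * a} ((+ 5) * (b * b) - - a * - a) a²≤5b² (solve (a ∷ b ∷ [])))))
≥0⇒NonNeg (a + b √5) (by-square⁻ a≥0 -b≥0 5b²≤a²) with nonpos⊎pos (- b)
... | inj₁ b≥0 = inj₁ (nonneg-by (- - a) a≥0 (neg-involutive a) , nonneg-by (- - b) b≥0 (neg-involutive b))
... | inj₂ -b≥1 = inj₂ (inj₁ (nonneg-by (- - a) a≥0 (neg-involutive a) , neg⇒<0 b -b≥1 ,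
      0≤i-j⇒j≤i (nonneg-by {a * a - (+ 5) * (b * b)} (- a * - a - (+ 5) * (b * b)) 5b²≤a² (solve (a ∷ b ∷ [])))))

≥0-+ : ∀ {x y} → x ≥0 → y ≥0 → x +√ y ≥0
≥0-+ {a + b √5} {c + d √5} p q = subst (_≤√5· b + d) (sym (neg-distrib-+ a c)) (≤√5·-+ p q)

3≤-if-√5≤ : ∀ P → 0ℤ ≤ P → 0ℤ ≤ P * P - (+ 5) → 0ℤ ≤ P - (+ 3)
3≤-if-√5≤ P P≥0 P²≥5 with nonpos⊎pos (P - (+ 2))
... | inj₂ P≥3 = nonneg-by (P - (+ 2) - 1ℤ) P≥3 (solve (P ∷ []))
... | inj₁ P≤2 = ⊥-elim (pos⇒¬nonpos (P * P - (+ 4))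
  (nonneg-by (P * P - (+ 5)) P²≥5 (solve (P ∷ [])))
  (nonneg-by ((+ 2) * (+ 2) - P * P) (square-mono P (+ 2) P≥0 (nonneg-by (- (P - (+ 2))) P≤2 (solve (P ∷ []))))
             (solve (P ∷ []))))

¬-8≤√5·≤-4 : ∀ {β} → 0ℤ ≤ - β - (+ 4) → ¬ (- (+ 8) ≤√5· β)
¬-8≤√5·≤-4 {β} β≤-4 h = pos⇒¬nonpos ((+ 5) * (β * β) - (+ 64))
  (nonneg-by ((+ 5) * ((- β - (+ 4)) * (- β - (+ 4)) + (+ 8) * (- β - (+ 4))) + (+ 15))
             (+-nonneg (scale-nonneg 5 (+-nonneg (square-nonneg (- β - (+ 4))) (scale-nonneg 8 β≤-4))) (+≤+ z≤n))
             (solve (β ∷ [])))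
  (nonneg-by (- (+ 8) * - (+ 8) - (+ 5) * (β * β)) (≤√5·-square⁻ β≤-1 h) (solve (β ∷ [])))
  where
  β≤-1 : 0ℤ ≤ - β - 1ℤ
  β≤-1 = nonneg-by ((- β - (+ 4)) + (+ 3)) (+-nonneg β≤-4 (+≤+ z≤n)) (solve (β ∷ []))

≥3-√5-if-conj≤8 : ∀ x → x ≢ fromℤ 0ℤ → x ≥0 → conj x ≥0 → fromℤ (+ 8) -√ conj x ≥0 →
        x -√ ((+ 3) + -1ℤ √5) ≥0
≥3-√5-if-conj≤8 (P + Q √5) x≢0 x≥0 x̄≥0 x̄≤8 = [ Q≥0⇒ , Q≤-1⇒ ]′ (nonpos⊎pos (- Q))
  where
  Q≥0⇒ : 0ℤ ≤ - - Q → - (P - (+ 3)) ≤√5· Q - -1ℤ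
  Q≥0⇒ Q≥0 with nonpos⊎pos P
  ... | inj₂ P≥1 =
    ≤√5·-monoˡ {n = + 2} (nonneg-by (P - 1ℤ) P≥1 (solve (P ∷ [])))
      (≤√5·-monoʳ {β = 1ℤ} (nonneg-by (- - Q) Q≥0 (solve (Q ∷ []))) (by-square⁺ (+≤+ z≤n) (+≤+ z≤n) (+≤+ z≤n)))
  ... | inj₁ P≤0 = ⊥-elim (x≢0 (cong₂ _+_√5 P≡0 Q≡0))
    where
    P≡0 : P ≡ 0ℤ
    P≡0 = nonneg∧nonpos⇒0 P (nonneg-by (- - P) (≤√5·-nonpos Q≥0 x̄≥0) (neg-involutive P)) P≤0
    Q≡0 : Q ≡ 0ℤ
    Q≡0 = nonneg∧nonpos⇒0 Q (nonneg-by (- - Q) Q≥0 (neg-involutive Q)) (≤√5·-nonneg P≤0 x̄≥0)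

  Q≤-1⇒ : 0ℤ ≤ - Q - 1ℤ → - (P - (+ 3)) ≤√5· Q - -1ℤ
  Q≤-1⇒ Q≤-1 = [ Q≡-1⇒ , Q≤-2⇒ ]′ (nonpos⊎pos (- Q - 1ℤ))
    where
    Q≡-1⇒ : 0ℤ ≤ - (- Q - 1ℤ) → - (P - (+ 3)) ≤√5· Q - -1ℤ
    Q≡-1⇒ Q≥-1 = by-sign (nonneg-by (P - (+ 3)) (3≤-if-√5≤ P P≥0 P²≥5) (solve (P ∷ [])))
                         (nonneg-by (- (- Q - 1ℤ)) Q≥-1 (solve (Q ∷ [])))
      where
      P≥0 : 0ℤ ≤ P
      P≥0 = nonneg-by (- - P) (≤√5·-nonpos (pos⇒nonneg (- Q) Q≤-1) x≥0) (neg-involutive P)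
      P²≥5 : 0ℤ ≤ P * P - (+ 5)
      P²≥5 = nonneg-by ((- P * - P - (+ 5) * (Q * Q)) + (+ 5) * (- Q * - Q - 1ℤ))
        (+-nonneg (≤√5·-square⁻ Q≤-1 x≥0) (scale-nonneg 5 (square-pos (- Q) Q≤-1))) (solve (P ∷ Q ∷ []))

    Q≤-2⇒ : 0ℤ ≤ - Q - 1ℤ - 1ℤ → - (P - (+ 3)) ≤√5· Q - -1ℤ
    Q≤-2⇒ Q≤-2 = ⊥-elim (¬-8≤√5·≤-4 {Q + Q}
      (nonneg-by ((- Q - 1ℤ - 1ℤ) + (- Q - 1ℤ - 1ℤ)) (+-nonneg Q≤-2 Q≤-2) (solve (Q ∷ [])))
      (≤√5·-subst (≤√5·-+ x≥0 x̄≤8′) (solve (P ∷ [])) refl))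
      where
      x̄≤8′ : P - (+ 8) ≤√5· Q
      x̄≤8′ = ≤√5·-subst x̄≤8 rat-eq irr-eq
        where
        rat-eq : - ((+ 8) - P) ≡ P - (+ 8)
        rat-eq = solve (P ∷ [])
        irr-eq : 0ℤ - - Q ≡ Q
        irr-eq = solve (Q ∷ [])

-- The quadratic form twiceAbsSq

-- R and I are the rational part and the √5-part of twiceAbsSq (cyc x0 x1 x2 x3 x4).
-- They are supplied as λ-terms, so that inside each field the ring solver sees
-- explicit polynomials; twiceAbsSq itself hides them behind local definitions.
record TwiceAbsSqLaws (R I : ℤ → ℤ → ℤ → ℤ → ℤ → ℤ) : Set where
  field
    R∘σ : ∀ x0 x1 x2 x3 x4 → R x0 x3 x1 x4 x2 ≡ R x0 x1 x2 x3 x4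
    I∘σ : ∀ x0 x1 x2 x3 x4 → I x0 x3 x1 x4 x2 ≡ - I x0 x1 x2 x3 x4
    R-parallelogram : ∀ a0 a1 a2 a3 a4 b0 b1 b2 b3 b4 →
      R (a0 - b0) (a1 - b1) (a2 - b2) (a3 - b3) (a4 - b4) + R (a0 + b0) (a1 + b1) (a2 + b2) (a3 + b3) (a4 + b4)
        ≡ (+ 2) * (R a0 a1 a2 a3 a4 + R b0 b1 b2 b3 b4)
    I-parallelogram : ∀ a0 a1 a2 a3 a4 b0 b1 b2 b3 b4 →
      I (a0 - b0) (a1 - b1) (a2 - b2) (a3 - b3) (a4 - b4) + I (a0 + b0) (a1 + b1) (a2 + b2) (a3 + b3) (a4 + b4)
        ≡ (+ 2) * (I a0 a1 a2 a3 a4 + I b0 b1 b2 b3 b4)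
    nonneg : ∀ x0 x1 x2 x3 x4 → - R x0 x1 x2 x3 x4 ≤√5· I x0 x1 x2 x3 x4
    pairwise-squares : ∀ x0 x1 x2 x3 x4 → let sq = λ (t : ℤ) → t * t in
      R x0 x1 x2 x3 x4 * (+ 2)
        ≡ sq (x0 - x4) + (sq (x1 - x4) + (sq (x2 - x4) + (sq (x3 - x4) + (sq (x0 - x1) +
          (sq (x0 - x2) + (sq (x0 - x3) + (sq (x1 - x2) + (sq (x1 - x3) + sq (x2 - x3)))))))))

twiceAbsSq-laws :
  TwiceAbsSqLaws (λ x0 x1 x2 x3 x4 → (+ 2) * (x0 * x0 + x1 * x1 + x2 * x2 + x3 * x3 + x4 * x4)
                                   - (x0 * x1 + x1 * x2 + x2 * x3 + x3 * x4 + x4 * x0)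
                                   - (x0 * x2 + x1 * x3 + x2 * x4 + x3 * x0 + x4 * x1))
             (λ x0 x1 x2 x3 x4 → (x0 * x1 + x1 * x2 + x2 * x3 + x3 * x4 + x4 * x0)
                                   - (x0 * x2 + x1 * x3 + x2 * x4 + x3 * x0 + x4 * x1))
twiceAbsSq-laws = record
  { R∘σ              = solve-∀
  ; I∘σ              = solve-∀
  ; R-parallelogram  = solve-∀
  ; I-parallelogram  = solve-∀
  ; nonneg           = λ x0 x1 x2 x3 x4 →
      -- 32 (R + I√5) = y₁² + y₂² + y₃² with yᵢ = pᵢ + qᵢ√5, where y₁ = 8 Re z and
      -- y₂² + y₃² = (8 Im z)² for z = Σ xₖ ζᵏ
      let p₁ = (+ 2) * ((+ 4) * x0 - (x1 + x4) - (x2 + x3)) ; q₁ = (+ 2) * ((x1 + x4) - (x2 + x3))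
          p₂ = (+ 2) * (x1 - x4) + (+ 4) * (x2 - x3)       ; q₂ = (+ 2) * (x1 - x4)
          p₃ = (+ 4) * (x1 - x4) - (+ 2) * (x2 - x3)       ; q₃ = (+ 2) * (x2 - x3)
      in ≤√5·-*-cancelʳ (+ 32) (+≤+ z≤n)
           (≤√5·-subst (≤√5·-+ (≤√5·-+ (square-≤√5· p₁ q₁) (square-≤√5· p₂ q₂)) (square-≤√5· p₃ q₃))
                       (solve (x0 ∷ x1 ∷ x2 ∷ x3 ∷ x4 ∷ [])) (solve (x0 ∷ x1 ∷ x2 ∷ x3 ∷ x4 ∷ [])))
  ; pairwise-squares = solve-∀
  }

open TwiceAbsSqLaws twiceAbsSq-laws

infixl 6 _+C_ _-C_

_+C_ : Cyc5 → Cyc5 → Cyc5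
cyc a0 a1 a2 a3 a4 +C cyc b0 b1 b2 b3 b4 = cyc (a0 + b0) (a1 + b1) (a2 + b2) (a3 + b3) (a4 + b4)

_-C_ : Cyc5 → Cyc5 → Cyc5
cyc a0 a1 a2 a3 a4 -C cyc b0 b1 b2 b3 b4 = cyc (a0 - b0) (a1 - b1) (a2 - b2) (a3 - b3) (a4 - b4)

toCyc-−K : ∀ z₁ z₂ → toCyc (z₁ -K z₂) ≡ toCyc z₁ -C toCyc z₂
toCyc-−K (ok _ _ _ _) (ok _ _ _ _) = refl

σ-−C : ∀ u v → σ (u -C v) ≡ σ u -C σ v
σ-−C (cyc _ _ _ _ _) (cyc _ _ _ _ _) = refl

twiceAbsSq-σ : ∀ u → twiceAbsSq (σ u) ≡ conj (twiceAbsSq u)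
twiceAbsSq-σ (cyc x0 x1 x2 x3 x4) = cong₂ _+_√5 (R∘σ x0 x1 x2 x3 x4) (I∘σ x0 x1 x2 x3 x4)

twiceAbsSq-parallelogram : ∀ u v →
  twiceAbsSq (u -C v) +√ twiceAbsSq (u +C v) ≡ (+ 2) ·√ (twiceAbsSq u +√ twiceAbsSq v)
twiceAbsSq-parallelogram (cyc a0 a1 a2 a3 a4) (cyc b0 b1 b2 b3 b4) =
  cong₂ _+_√5 (R-parallelogram a0 a1 a2 a3 a4 b0 b1 b2 b3 b4) (I-parallelogram a0 a1 a2 a3 a4 b0 b1 b2 b3 b4)

twiceAbsSq-nonneg : ∀ u → twiceAbsSq u ≥0
twiceAbsSq-nonneg (cyc x0 x1 x2 x3 x4) = nonneg x0 x1 x2 x3 x4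

rearrange-≤8 : ∀ {t₋ t₊ tu tv} → t₋ +√ t₊ ≡ (+ 2) ·√ (tu +√ tv) →
  (fromℤ (+ 2) -√ tu) +√ (fromℤ (+ 2) -√ tu) +√ ((fromℤ (+ 2) -√ tv) +√ (fromℤ (+ 2) -√ tv)) +√ t₊
    ≡ fromℤ (+ 8) -√ t₋
rearrange-≤8 {a + b √5} {c + d √5} {e + f √5} {g + h √5} law =
  cong₂ _+_√5 (rearrange (+ 2) {a} {c} {e} {g} (cong rat law)) (rearrange 0ℤ {b} {d} {f} {h} (cong irr law))
  where
  rearrange : ∀ k {t s u v} → t + s ≡ (+ 2) * (u + v) →
              ((k - u) + (k - u)) + ((k - v) + (k - v)) + s ≡ (+ 4) * k - t
  rearrange k {t} {s} {u} {v} law′ = begin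
    ((k - u) + (k - u)) + ((k - v) + (k - v)) + s ≡⟨ solve (k ∷ s ∷ u ∷ v ∷ []) ⟩
    (+ 4) * k - (+ 2) * (u + v) + s               ≡⟨ cong (λ w → (+ 4) * k - w + s) (sym law′) ⟩
    (+ 4) * k - (t + s) + s                       ≡⟨ solve (k ∷ t ∷ s ∷ []) ⟩
    (+ 4) * k - t                                 ∎

twiceAbsSq-diff-≤8 : ∀ u v → fromℤ (+ 2) -√ twiceAbsSq u ≥0 → fromℤ (+ 2) -√ twiceAbsSq v ≥0 →
                     fromℤ (+ 8) -√ twiceAbsSq (u -C v) ≥0
twiceAbsSq-diff-≤8 u v u≤2 v≤2 =
  subst _≥0 (rearrange-≤8 {twiceAbsSq (u -C v)} {twiceAbsSq (u +C v)} {twiceAbsSq u} {twiceAbsSq v}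
                           (twiceAbsSq-parallelogram u v))
        (≥0-+ (≥0-+ (≥0-+ u≤2 u≤2) (≥0-+ v≤2 v≤2)) (twiceAbsSq-nonneg (u +C v)))

ok-cong : ∀ {a0 a1 a2 a3 b0 b1 b2 b3} → a0 ≡ b0 → a1 ≡ b1 → a2 ≡ b2 → a3 ≡ b3 →
          ok a0 a1 a2 a3 ≡ ok b0 b1 b2 b3
ok-cong refl refl refl refl = refl

twiceAbsSq-toCyc-definite : ∀ z → twiceAbsSq (toCyc z) ≡ fromℤ 0ℤ → z ≡ ok 0ℤ 0ℤ 0ℤ 0ℤ
twiceAbsSq-toCyc-definite (ok x0 x1 x2 x3) e = coefficients≡0 (sumOfSquares≡0 differences sumOfSquares≡0′)
  where
  differences : List ℤ
  differences = x0 - 0ℤ ∷ x1 - 0ℤ ∷ x2 - 0ℤ ∷ x3 - 0ℤ ∷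
                x0 - x1 ∷ x0 - x2 ∷ x0 - x3 ∷ x1 - x2 ∷ x1 - x3 ∷ x2 - x3 ∷ []
  sumOfSquares≡0′ : sumOfSquares differences ≡ 0ℤ
  sumOfSquares≡0′ = trans (sym (pairwise-squares x0 x1 x2 x3 0ℤ)) (cong (λ w → rat w * (+ 2)) e)
  coefficients≡0 : All (_≡ 0ℤ) differences → ok x0 x1 x2 x3 ≡ ok 0ℤ 0ℤ 0ℤ 0ℤ
  coefficients≡0 (e0 All.∷ e1 All.∷ e2 All.∷ e3 All.∷ _) =
    ok-cong (i-j≡0⇒i≡j x0 0ℤ e0) (i-j≡0⇒i≡j x1 0ℤ e1) (i-j≡0⇒i≡j x2 0ℤ e2) (i-j≡0⇒i≡j x3 0ℤ e3)

-K≡0⇒≡ : ∀ z₁ z₂ → z₁ -K z₂ ≡ ok 0ℤ 0ℤ 0ℤ 0ℤ → z₁ ≡ z₂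
-K≡0⇒≡ (ok a0 a1 a2 a3) (ok b0 b1 b2 b3) e =
  ok-cong (i-j≡0⇒i≡j a0 b0 (cong c0 e)) (i-j≡0⇒i≡j a1 b1 (cong c1 e))
          (i-j≡0⇒i≡j a2 b2 (cong c2 e)) (i-j≡0⇒i≡j a3 b3 (cong c3 e))

mainTheorem5 : (z₁ z₂ : OK) → InS z₁ → InS z₂ → ¬ (z₁ ≡ z₂) →
    ((+ 3) + -[1+ 0 ] √5) ≤√ twiceAbsSq (toCyc (z₁ -K z₂))
mainTheorem5 z₁ z₂ z₁∈S z₂∈S z₁≢z₂ =
  ≥0⇒NonNeg _ (≥3-√5-if-conj≤8 x x≢0 (twiceAbsSq-nonneg d) x̄≥0 x̄≤8)
  where
  d : Cyc5
  d = toCyc (z₁ -K z₂)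
  x : ℤ√5
  x = twiceAbsSq d
  x≢0 : x ≢ fromℤ 0ℤ
  x≢0 = z₁≢z₂ ∘ -K≡0⇒≡ z₁ z₂ ∘ twiceAbsSq-toCyc-definite (z₁ -K z₂)
  x̄≥0 : conj x ≥0
  x̄≥0 = subst _≥0 (twiceAbsSq-σ d) (twiceAbsSq-nonneg (σ d))
  σd≡ : σ d ≡ σ (toCyc z₁) -C σ (toCyc z₂)
  σd≡ = trans (cong σ (toCyc-−K z₁ z₂)) (σ-−C (toCyc z₁) (toCyc z₂))
  x̄≤8 : fromℤ (+ 8) -√ conj x ≥0
  x̄≤8 = subst (λ y → fromℤ (+ 8) -√ y ≥0) (trans (cong twiceAbsSq (sym σd≡)) (twiceAbsSq-σ d))
              (twiceAbsSq-diff-≤8 (σ (toCyc z₁)) (σ (toCyc z₂))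
                                  (NonNeg⇒≥0 _ z₁∈S) (NonNeg⇒≥0 _ z₂∈S))
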